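{- Let $G$ be a bipartite permutation graph with $n$ vertices. Then the lettericity of $G$ is at most $\lfloor n/2\rfloor+1$.
   Context: A bipartite permutation graph is a graph that is both bipartite and a permutation graph. Given a finite alphabet $A$, a decoder $D\subseteq A^2$ and a word $w=w_1\cdots w_n$ over $A$, the letter graph $G(D,w)$ has vertex set $\{1,\ldots,n\}$, with $i<j$ adjacent iff $(w_i,w_j)\in D$. The lettericity of a graph $G$ is the minimum $k$ such that $G$ is isomorphic to $G(D,w)$ for some alphabet $A$ with $|A|=k$, some $D\subseteq A^2$ and some word $w$ over $A$. -}

module Defs where

open import Data.Nat using (ℕ; _<ᵇ_)
open import Data.Fin using (Fin; toℕ)
open import Data.Bool using (Bool; true; false; if_then_else_; _xor_)
open import Data.Product using (Σ; ∃; _×_; _,_)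
open import Relation.Binary.PropositionalEquality using (_≡_)
open import Relation.Nullary using (¬_)
open import Function.Definitions using (Injective)

record Graph (n : ℕ) : Set where
  field
    adj   : Fin n → Fin n → Bool
    sym   : ∀ u v → adj u v ≡ adj v u
    irrfl : ∀ v → adj v v ≡ false
open Graph public

_<F_ : ∀ {n} → Fin n → Fin n → Bool
i <F j = toℕ i <ᵇ toℕ j

IsBipartite : ∀ {n} → Graph n → Set
IsBipartite {n} G = Σ (Fin n → Bool) λ c → ∀ u v → adj G u v ≡ true → ¬ (c u ≡ c v)

-- Permutation graph: G is isomorphic to the inversion graph of a permutation,
-- i.e. there are two linear orders (injections σ τ into positions 0..n-1)
-- such that u,v are adjacent iff σ and τ order u,v differently.
IsPermutationGraph : ∀ {n} → Graph n → Set
IsPermutationGraph {n} G =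
  Σ (Fin n → Fin n) λ σ → Σ (Fin n → Fin n) λ τ →
    Injective _≡_ _≡_ σ × Injective _≡_ _≡_ τ ×
    (∀ u v → adj G u v ≡ ((σ u <F σ v) xor (τ u <F τ v)))

letterAdj : ∀ {n k} → (Fin k → Fin k → Bool) → (Fin n → Fin k) → Fin n → Fin n → Bool
letterAdj D w i j =
  if i <F j then D (w i) (w j)
  else (if j <F i then D (w j) (w i) else false)

IsLetterGraphOver : ∀ {n} → ℕ → Graph n → Set
IsLetterGraphOver {n} k G =
  Σ (Fin k → Fin k → Bool) λ D → Σ (Fin n → Fin k) λ w →
  Σ (Fin n → Fin n) λ f → Injective _≡_ _≡_ f ×
    (∀ u v → adj G u v ≡ letterAdj D w (f u) (f v))

LettericityAtMost : ∀ {n} → ℕ → Graph n → Set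
LettericityAtMost m G = ∃ λ k → k Data.Nat.≤ m × IsLetterGraphOver k G

-- Realise G as the inversion graph of a permutation, i.e. as points in the plane with u, v
-- adjacent iff they cross (one is higher, the other to the right). A colour class is
-- independent, hence a chain r₁ ≺ r₂ ≺ ⋯ ≺ r_p; take R to be the smaller class, so p ≤ n/2.
-- For a vertex v let Lo v be the number of reds weakly below-left of v and Up v the number
-- of reds not strictly above-right of v; the reds counted are the prefixes r₁ … r_{Lo v} and
-- r₁ … r_{Up v}, and a blue v is adjacent to r_i exactly when Lo v < i ≤ Up v, while
-- Lo r_i = Up r_i = i. Writing the vertices in increasing order of Up, reds before blues on
-- ties, then by Lo, the later of two vertices is adjacent to the earlier one iff its letter
-- Lo is smaller. So the letters 0 … p, with decoder "later letter < earlier letter", suffice.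

module Submission where

open import Defs
open import Data.Nat using (ℕ; _+_)
open import Data.Nat.DivMod using (_/_)

open import Level using (Level; 0ℓ)
open import Function.Base using (_∘_)
open import Function.Bundles using (Equivalence)
open import Function.Definitions using (Injective)
open import Data.Bool.Base using (Bool; true; false; not; _xor_; if_then_else_)
open import Data.Bool.Properties as Bool using (T-≡; ¬-not)
open import Data.Product.Base using (∃; _×_; _,_; proj₁; proj₂)
open import Data.Sum.Base using (_⊎_; inj₁; inj₂)
open import Data.Nat.Base as ℕ using (suc; _≤_; _<_; _<ᵇ_; _∸_; s≤s)
open import Data.Nat.Properties as ℕ
  using (<-cmp; ≤-refl; ≤-trans; <-≤-trans; ≤-<-trans; <⇒≤; <⇒≱; <⇒≢; ≤-reflexive; ≤-antisym;
         <-irrefl; <-asym; <ᵇ⇒<; <⇒<ᵇ; ≤-total; +-monoʳ-≤; +-monoˡ-≤; m+[n∸m]≡n)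
open import Data.Nat.DivMod using (m*n/n≡m; /-monoˡ-≤)
open import Data.Fin.Base as Fin using (Fin; toℕ; fromℕ<)
open import Data.Fin.Properties using (toℕ-injective; toℕ-fromℕ<; any?; _≟_)
open import Data.Fin.Subset using (Subset; _∈_; _⊆_; ∣_∣; ∁)
open import Data.Fin.Subset.Properties using (p⊆q⇒∣p∣≤∣q∣; p⊂q⇒∣p∣<∣q∣; ∣⊤∣≡n; ∈⊤; ∣∁p∣≡n∸∣p∣; ∣p∣≤n)
open import Data.Vec.Base using (Vec; []; _∷_; tabulate)
open import Data.Vec.Properties using (lookup∘tabulate; []=⇒lookup; lookup⇒[]=; tabulate-cong; tabulate-∘)
open import Data.Vec.Relation.Binary.Lex.Strict using (Lex-<; this; next; <-isStrictTotalOrder)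
open import Data.Vec.Relation.Binary.Pointwise.Inductive using (Pointwise; []; _∷_)
open import Relation.Binary.Core using (Rel)
open import Relation.Binary.Definitions using (tri<; tri≈; tri>)
open import Relation.Binary.Structures using (IsStrictTotalOrder)
import Relation.Binary.PropositionalEquality as ≡
open ≡ using (_≡_; refl; trans; cong; cong₂; subst₂; module ≡-Reasoning)
open import Relation.Nullary.Decidable using (Dec; yes; no; does; proof; dec-true; dec-false; _×-dec_; ¬?)
open import Relation.Nullary.Negation using (¬_; contradiction)
open import Relation.Nullary.Reflects using (Reflects; invert)
open import Relation.Unary using (Pred; Decidable)

private
  variable
    p q : Level
    n : ℕ

<ᵇ-true : ∀ {m k} → m < k → (m <ᵇ k) ≡ true
<ᵇ-true = Equivalence.to T-≡ ∘ <⇒<ᵇ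

<ᵇ-false : ∀ {m k} → k ≤ m → (m <ᵇ k) ≡ false
<ᵇ-false {m} {k} k≤m = ¬-not (λ m<k → <⇒≱ (<ᵇ⇒< m k (Equivalence.from T-≡ m<k)) k≤m)

m+m≤n⇒m≤n/2 : ∀ {m} → m + m ≤ n → m ≤ n / 2
m+m≤n⇒m≤n/2 {n} {m} m+m≤n = ≡.subst (_≤ n / 2) (m*n/n≡m m 2) (/-monoˡ-≤ 2 m*2≤n)
  where
  m*2≤n : m ℕ.* 2 ≤ n
  m*2≤n = ≡.subst (_≤ n) (≡.sym (trans (ℕ.*-comm m 2) (cong (m +_) (ℕ.+-identityʳ m)))) m+m≤n

module _ {P : Pred (Fin n) p} (P? : Decidable P) where

  toSubset : Subset n
  toSubset = tabulate (does ∘ P?)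

  ∈-toSubset⁺ : ∀ {x} → P x → x ∈ toSubset
  ∈-toSubset⁺ {x} px = lookup⇒[]= x toSubset (trans (lookup∘tabulate (does ∘ P?) x) (dec-true (P? x) px))

  ∈-toSubset⁻ : ∀ {x} → x ∈ toSubset → P x
  ∈-toSubset⁻ {x} x∈ = invert (≡.subst (Reflects (P x)) does≡true (proof (P? x)))
    where
    does≡true : does (P? x) ≡ true
    does≡true = trans (≡.sym (lookup∘tabulate (does ∘ P?) x)) ([]=⇒lookup x∈)

module _ {P : Pred (Fin n) p} {Q : Pred (Fin n) q} (P? : Decidable P) (Q? : Decidable Q)
         (P⊆Q : ∀ {x} → P x → Q x) where

  toSubset-⊆ : toSubset P? ⊆ toSubset Q?
  toSubset-⊆ = ∈-toSubset⁺ Q? ∘ P⊆Q ∘ ∈-toSubset⁻ P?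

  ∣toSubset∣-mono-≤ : ∣ toSubset P? ∣ ≤ ∣ toSubset Q? ∣
  ∣toSubset∣-mono-≤ = p⊆q⇒∣p∣≤∣q∣ toSubset-⊆

  ∣toSubset∣-mono-< : ∀ {x} → Q x → ¬ P x → ∣ toSubset P? ∣ < ∣ toSubset Q? ∣
  ∣toSubset∣-mono-< {x} qx ¬px =
    p⊂q⇒∣p∣<∣q∣ (toSubset-⊆ , x , ∈-toSubset⁺ Q? qx , ¬px ∘ ∈-toSubset⁻ P?)

smallerSide : (s : Subset n) → ∣ s ∣ + ∣ s ∣ ≤ n ⊎ ∣ ∁ s ∣ + ∣ ∁ s ∣ ≤ n
smallerSide {n} s with ≤-total ∣ s ∣ (n ∸ ∣ s ∣)
... | inj₁ s≤∁s = inj₁ (≤-trans (+-monoʳ-≤ ∣ s ∣ s≤∁s) (≤-reflexive (m+[n∸m]≡n (∣p∣≤n s))))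
... | inj₂ ∁s≤s = inj₂ (≡.subst (λ k → k + k ≤ n) (≡.sym (∣∁p∣≡n∸∣p∣ s))
                         (≤-trans (+-monoˡ-≤ (n ∸ ∣ s ∣) ∁s≤s) (≤-reflexive (m+[n∸m]≡n (∣p∣≤n s)))))

colourClass : (Fin n → Bool) → Bool → Subset n
colourClass c b = toSubset (λ v → c v Bool.≟ b)

colourClass-false : (c : Fin n → Bool) → colourClass c false ≡ ∁ (colourClass c true)
colourClass-false c = trans (tabulate-cong does-≟-false) (tabulate-∘ not (λ v → does (c v Bool.≟ true)))
  where
  does-≟-false : ∀ v → does (c v Bool.≟ false) ≡ not (does (c v Bool.≟ true))
  does-≟-false v with c v
  ... | true  = refl
  ... | false = refl

smallColourClass : (c : Fin n → Bool) → ∃ λ b → ∣ colourClass c b ∣ + ∣ colourClass c b ∣ ≤ n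
smallColourClass c with smallerSide (colourClass c true)
... | inj₁ small = true , small
... | inj₂ small = false , ≡.subst (λ s → ∣ s ∣ + ∣ s ∣ ≤ _) (≡.sym (colourClass-false c)) small

module Ranking {a ℓ₁ ℓ₂} {A : Set a} {_≈_ : Rel A ℓ₁} {_≺_ : Rel A ℓ₂}
               (≺-isStrictTotalOrder : IsStrictTotalOrder _≈_ _≺_)
               (key : Fin n → A) (key-injective : ∀ {u v} → key u ≈ key v → u ≡ v) where

  open IsStrictTotalOrder ≺-isStrictTotalOrder using (module Eq; irrefl; compare; _<?_)
    renaming (trans to ≺-trans)

  predecessors : Fin n → Subset n
  predecessors v = toSubset (λ u → key u <? key v)

  ∣predecessors∣<n : ∀ v → ∣ predecessors v ∣ < n
  ∣predecessors∣<n v = ≡.subst (∣ predecessors v ∣ <_) (∣⊤∣≡n n)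
    (p⊂q⇒∣p∣<∣q∣ ((λ _ → ∈⊤) , v , ∈⊤ , irrefl Eq.refl ∘ ∈-toSubset⁻ (λ u → key u <? key v)))

  rank : Fin n → Fin n
  rank v = fromℕ< (∣predecessors∣<n v)

  rank-< : ∀ {u v} → key u ≺ key v → rank u Fin.< rank v
  rank-< {u} {v} u≺v = subst₂ _<_ (≡.sym (toℕ-fromℕ< _)) (≡.sym (toℕ-fromℕ< _))
    (∣toSubset∣-mono-< (λ w → key w <? key u) (λ w → key w <? key v) (λ w≺u → ≺-trans w≺u u≺v)
                       u≺v (irrefl Eq.refl))

  rank-injective : Injective _≡_ _≡_ rank
  rank-injective {u} {v} ru≡rv with compare (key u) (key v)
  ... | tri< u≺v _ _ = contradiction (cong toℕ ru≡rv) (<⇒≢ (rank-< u≺v))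
  ... | tri≈ _ u≈v _ = key-injective u≈v
  ... | tri> _ _ v≺u = contradiction (cong toℕ (≡.sym ru≡rv)) (<⇒≢ (rank-< v≺u))

  rank-<⁻ : ∀ {u v} → rank u Fin.< rank v → key u ≺ key v
  rank-<⁻ {u} {v} ru<rv with compare (key u) (key v)
  ... | tri< u≺v _ _ = u≺v
  ... | tri≈ _ u≈v _ = contradiction (cong (toℕ ∘ rank) (key-injective u≈v)) (<⇒≢ ru<rv)
  ... | tri> _ _ v≺u = contradiction (rank-< v≺u) (<-asym ru<rv)

module _ {n k} (D : Fin k → Fin k → Bool) (w : Fin n → Fin k) where

  letterAdj-< : ∀ {i j} → i Fin.< j → letterAdj D w i j ≡ D (w i) (w j)
  letterAdj-< i<j rewrite <ᵇ-true i<j = refl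

  letterAdj-> : ∀ {i j} → j Fin.< i → letterAdj D w i j ≡ D (w j) (w i)
  letterAdj-> j<i rewrite <ᵇ-false (<⇒≤ j<i) | <ᵇ-true j<i = refl

  letterAdj-refl : ∀ i → letterAdj D w i i ≡ false
  letterAdj-refl i rewrite <ᵇ-false (≤-refl {toℕ i}) = refl

letterGraph-byOrder : ∀ {n k} (G : Graph n) (pos : Fin n → Fin n) → Injective _≡_ _≡_ pos →
  (letter : Fin n → Fin k) (D : Fin k → Fin k → Bool) →
  (∀ {u v} → pos u Fin.< pos v → adj G u v ≡ D (letter u) (letter v)) →
  IsLetterGraphOver k G
letterGraph-byOrder {n} {k} G pos pos-injective letter D adj-ordered =
  D , w , pos , pos-injective , adj≡letterAdj
  where
  -- Off the image of pos the letter is irrelevant.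
  w : Fin n → Fin k
  w i with any? (λ v → pos v ≟ i)
  ... | yes (v , _) = letter v
  ... | no _        = letter i

  w∘pos : ∀ v → w (pos v) ≡ letter v
  w∘pos v with any? (λ u → pos u ≟ pos v)
  ... | yes (u , pos-u≡pos-v) = cong letter (pos-injective pos-u≡pos-v)
  ... | no  ∄u               = contradiction (v , refl) ∄u

  adj≡letterAdj : ∀ u v → adj G u v ≡ letterAdj D w (pos u) (pos v)
  adj≡letterAdj u v with <-cmp (toℕ (pos u)) (toℕ (pos v))
  ... | tri< pu<pv _ _ = begin
    adj G u v                       ≡⟨ adj-ordered pu<pv ⟩
    D (letter u) (letter v)         ≡⟨ ≡.sym (cong₂ D (w∘pos u) (w∘pos v)) ⟩
    D (w (pos u)) (w (pos v))       ≡⟨ ≡.sym (letterAdj-< D w pu<pv) ⟩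
    letterAdj D w (pos u) (pos v)   ∎
    where open ≡-Reasoning
  ... | tri≈ _ pu≡pv _ rewrite pos-injective (toℕ-injective pu≡pv) =
    trans (irrfl G v) (≡.sym (letterAdj-refl D w (pos v)))
  ... | tri> _ _ pv<pu = begin
    adj G u v                       ≡⟨ Graph.sym G u v ⟩
    adj G v u                       ≡⟨ adj-ordered pv<pu ⟩
    D (letter v) (letter u)         ≡⟨ ≡.sym (cong₂ D (w∘pos v) (w∘pos u)) ⟩
    D (w (pos v)) (w (pos u))       ≡⟨ ≡.sym (letterAdj-> D w pv<pu) ⟩
    letterAdj D w (pos u) (pos v)   ∎
    where open ≡-Reasoning

module PermutationGeometry {n} (G : Graph n) (σ τ : Fin n → Fin n)
  (σ-injective : Injective _≡_ _≡_ σ) (τ-injective : Injective _≡_ _≡_ τ)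
  (adj≡crossing : ∀ u v → adj G u v ≡ ((σ u <F σ v) xor (τ u <F τ v))) where

  X Y : Fin n → ℕ
  X = toℕ ∘ σ
  Y = toℕ ∘ τ

  infix 4 _≼_ _≺_ _≼?_ _≺?_

  _≼_ _≺_ : Rel (Fin n) 0ℓ
  u ≼ v = X u ≤ X v × Y u ≤ Y v
  u ≺ v = X u < X v × Y u < Y v

  _≼?_ : ∀ u v → Dec (u ≼ v)
  u ≼? v = X u ℕ.≤? X v ×-dec Y u ℕ.≤? Y v

  _≺?_ : ∀ u v → Dec (u ≺ v)
  u ≺? v = X u ℕ.<? X v ×-dec Y u ℕ.<? Y v

  Crossing : Rel (Fin n) 0ℓ
  Crossing u v = X u < X v × Y v < Y u ⊎ X v < X u × Y u < Y v

  ≼-refl : ∀ {v} → v ≼ v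
  ≼-refl = ≤-refl , ≤-refl

  ≼-trans : ∀ {u v w} → u ≼ v → v ≼ w → u ≼ w
  ≼-trans (x₁ , y₁) (x₂ , y₂) = ≤-trans x₁ x₂ , ≤-trans y₁ y₂

  ≺⇒≼ : ∀ {u v} → u ≺ v → u ≼ v
  ≺⇒≼ (x , y) = <⇒≤ x , <⇒≤ y

  ≼-≺-trans : ∀ {u v w} → u ≼ v → v ≺ w → u ≺ w
  ≼-≺-trans (x₁ , y₁) (x₂ , y₂) = ≤-<-trans x₁ x₂ , ≤-<-trans y₁ y₂

  ≺-≼-trans : ∀ {u v w} → u ≺ v → v ≼ w → u ≺ w
  ≺-≼-trans (x₁ , y₁) (x₂ , y₂) = <-≤-trans x₁ x₂ , <-≤-trans y₁ y₂

  ≼⇒⊁ : ∀ {u v} → u ≼ v → ¬ v ≺ u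
  ≼⇒⊁ (x₁ , _) (x₂ , _) = <⇒≱ x₂ x₁

  crossing⇒⋠ : ∀ {u v} → Crossing u v → ¬ u ≼ v
  crossing⇒⋠ (inj₁ (_ , y)) (_ , y′) = <⇒≱ y y′
  crossing⇒⋠ (inj₂ (x , _)) (x′ , _) = <⇒≱ x x′

  data Position (u v : Fin n) : Set where
    equal    : u ≡ v → Position u v
    below    : u ≺ v → Position u v
    above    : v ≺ u → Position u v
    crossing : Crossing u v → Position u v

  position : ∀ u v → Position u v
  position u v with <-cmp (X u) (X v) | <-cmp (Y u) (Y v)
  ... | tri≈ _ x _ | _          = equal (σ-injective (toℕ-injective x))
  ... | _          | tri≈ _ y _ = equal (τ-injective (toℕ-injective y))
  ... | tri< x _ _ | tri< y _ _ = below (x , y)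
  ... | tri< x _ _ | tri> _ _ y = crossing (inj₁ (x , y))
  ... | tri> _ _ x | tri< y _ _ = crossing (inj₂ (x , y))
  ... | tri> _ _ x | tri> _ _ y = above (x , y)

  adj-≺ : ∀ {u v} → u ≺ v → adj G u v ≡ false
  adj-≺ {u} {v} (x , y) = trans (adj≡crossing u v) (cong₂ _xor_ (<ᵇ-true x) (<ᵇ-true y))

  adj-crossing : ∀ {u v} → Crossing u v → adj G u v ≡ true
  adj-crossing {u} {v} (inj₁ (x , y)) =
    trans (adj≡crossing u v) (cong₂ _xor_ (<ᵇ-true x) (<ᵇ-false (<⇒≤ y)))
  adj-crossing {u} {v} (inj₂ (x , y)) =
    trans (adj≡crossing u v) (cong₂ _xor_ (<ᵇ-false (<⇒≤ x)) (<ᵇ-true y))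

  nonadjacent⇒¬crossing : ∀ {u v} → adj G u v ≡ false → ¬ Crossing u v
  nonadjacent⇒¬crossing ¬uv c with trans (≡.sym (adj-crossing c)) ¬uv
  ... | ()

  nonadjacent-⊁⇒≼ : ∀ {u v} → adj G u v ≡ false → ¬ v ≺ u → u ≼ v
  nonadjacent-⊁⇒≼ {u} {v} ¬uv v⊀u with position u v
  ... | equal refl = ≼-refl
  ... | below u≺v  = ≺⇒≼ u≺v
  ... | above v≺u  = contradiction v≺u v⊀u
  ... | crossing c = contradiction c (nonadjacent⇒¬crossing ¬uv)

module Lettering {n} (G : Graph n) (σ τ : Fin n → Fin n)
  (σ-injective : Injective _≡_ _≡_ σ) (τ-injective : Injective _≡_ _≡_ τ)
  (adj≡crossing : ∀ u v → adj G u v ≡ ((σ u <F σ v) xor (τ u <F τ v)))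
  {r} {Red : Pred (Fin n) r} (Red? : Decidable Red)
  (red-independent  : ∀ {u v} → Red u → Red v → adj G u v ≡ false)
  (blue-independent : ∀ {u v} → ¬ Red u → ¬ Red v → adj G u v ≡ false) where

  open PermutationGeometry G σ τ σ-injective τ-injective adj≡crossing

  redBelow? : ∀ v → Decidable (λ r → Red r × r ≼ v)
  redBelow? v r = Red? r ×-dec r ≼? v

  redNotAbove? : ∀ v → Decidable (λ r → Red r × ¬ v ≺ r)
  redNotAbove? v r = Red? r ×-dec ¬? (v ≺? r)

  Lo Up : Fin n → ℕ
  Lo v = ∣ toSubset (redBelow? v) ∣
  Up v = ∣ toSubset (redNotAbove? v) ∣

  red-⊁⇒≼ : ∀ {r v} → Red r → Red v → ¬ v ≺ r → r ≼ v
  red-⊁⇒≼ red-r red-v = nonadjacent-⊁⇒≼ (red-independent red-r red-v)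

  ≼-crossing⇒⊁ : ∀ {r u v} → r ≼ v → Crossing u v → ¬ u ≺ r
  ≼-crossing⇒⊁ r≼v c u≺r = crossing⇒⋠ c (≺⇒≼ (≺-≼-trans u≺r r≼v))

  Lo-mono : ∀ {u v} → u ≼ v → Lo u ≤ Lo v
  Lo-mono u≼v = ∣toSubset∣-mono-≤ (redBelow? _) (redBelow? _) λ (red , r≼u) → red , ≼-trans r≼u u≼v

  Up-mono : ∀ {u v} → u ≼ v → Up u ≤ Up v
  Up-mono u≼v = ∣toSubset∣-mono-≤ (redNotAbove? _) (redNotAbove? _)
    λ (red , u⊀r) → red , u⊀r ∘ ≼-≺-trans u≼v

  Up≡Lo : ∀ {v} → Red v → Up v ≡ Lo v
  Up≡Lo red-v = ≤-antisym
    (∣toSubset∣-mono-≤ (redNotAbove? _) (redBelow? _) λ (red , v⊀r) → red , red-⊁⇒≼ red red-v v⊀r)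
    (∣toSubset∣-mono-≤ (redBelow? _) (redNotAbove? _) λ (red , r≼v) → red , ≼⇒⊁ r≼v)

  Up-<-≺ : ∀ {u v} → Red u → v ≺ u → Up v < Up u
  Up-<-≺ red-u v≺u = ∣toSubset∣-mono-< (redNotAbove? _) (redNotAbove? _)
    (λ (red , v⊀r) → red , v⊀r ∘ ≼-≺-trans (≺⇒≼ v≺u))
    (red-u , ≼⇒⊁ ≼-refl) (λ (_ , v⊀u) → v⊀u v≺u)

  Lo-<-crossing : ∀ {u v} → Red u → Crossing u v → Lo v < Lo u
  Lo-<-crossing red-u c = ∣toSubset∣-mono-< (redBelow? _) (redBelow? _)
    (λ (red , r≼v) → red , red-⊁⇒≼ red red-u (≼-crossing⇒⊁ r≼v c))
    (red-u , ≼-refl) (crossing⇒⋠ c ∘ proj₂)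

  Up-≤-crossing : ∀ {u v} → Red v → Crossing u v → Up v ≤ Up u
  Up-≤-crossing red-v c = ∣toSubset∣-mono-≤ (redNotAbove? _) (redNotAbove? _)
    λ (red , v⊀r) → red , ≼-crossing⇒⊁ (red-⊁⇒≼ red red-v v⊀r) c

  blueBit : Fin n → ℕ
  blueBit v = if does (Red? v) then 0 else 1

  blueBit-red : ∀ {v} → Red v → blueBit v ≡ 0
  blueBit-red {v} red-v = cong (if_then 0 else 1) (dec-true (Red? v) red-v)

  blueBit-blue : ∀ {v} → ¬ Red v → blueBit v ≡ 1
  blueBit-blue {v} blue-v = cong (if_then 0 else 1) (dec-false (Red? v) blue-v)

  -- The last component only serves to make the key injective.
  key : Fin n → Vec ℕ 4
  key v = Up v ∷ blueBit v ∷ Lo v ∷ toℕ v ∷ []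

  key-injective : ∀ {u v} → Pointwise _≡_ (key u) (key v) → u ≡ v
  key-injective (_ ∷ _ ∷ _ ∷ u≡v ∷ []) = toℕ-injective u≡v

  infix 4 _⊏_
  _⊏_ : Rel (Fin n) 0ℓ
  u ⊏ v = Lex-< _≡_ _<_ (key u) (key v)

  ⊏⇒Up≤ : ∀ {u v} → u ⊏ v → Up u ≤ Up v
  ⊏⇒Up≤ (this Up< _)  = <⇒≤ Up<
  ⊏⇒Up≤ (next Up≡ _)  = ≤-reflexive Up≡

  blue⊏red⇒Up< : ∀ {u v} → ¬ Red u → Red v → u ⊏ v → Up u < Up v
  blue⊏red⇒Up< _ _ (this Up< _) = Up<
  blue⊏red⇒Up< blue-u red-v (next _ (this bit< _)) =
    contradiction (subst₂ _<_ (blueBit-blue blue-u) (blueBit-red red-v) bit<) λ ()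
  blue⊏red⇒Up< blue-u red-v (next _ (next bit≡ _)) =
    contradiction (trans (≡.sym (blueBit-blue blue-u)) (trans bit≡ (blueBit-red red-v))) λ ()

  blue⊏blue⇒Lo≤ : ∀ {u v} → ¬ Red u → ¬ Red v → Up u ≡ Up v → u ⊏ v → Lo u ≤ Lo v
  blue⊏blue⇒Lo≤ _ _ Up≡ (this Up< _) = contradiction Up≡ (<⇒≢ Up<)
  blue⊏blue⇒Lo≤ blue-u blue-v _ (next _ (this bit< _)) =
    contradiction (subst₂ _<_ (blueBit-blue blue-u) (blueBit-blue blue-v) bit<) (<-irrefl refl)
  blue⊏blue⇒Lo≤ _ _ _ (next _ (next _ (this Lo< _))) = <⇒≤ Lo<
  blue⊏blue⇒Lo≤ _ _ _ (next _ (next _ (next Lo≡ _))) = ≤-reflexive Lo≡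

  nonadjacent-Lo≤⇒adj≡ : ∀ {u v} → adj G u v ≡ false → Lo u ≤ Lo v → adj G u v ≡ (Lo v <ᵇ Lo u)
  nonadjacent-Lo≤⇒adj≡ ¬uv Lo≤ = trans ¬uv (≡.sym (<ᵇ-false Lo≤))

  adj-⊏-red-red : ∀ {u v} → Red u → Red v → u ⊏ v → adj G u v ≡ (Lo v <ᵇ Lo u)
  adj-⊏-red-red {u} {v} red-u red-v u⊏v = nonadjacent-Lo≤⇒adj≡ (red-independent red-u red-v) (begin
    Lo u  ≡⟨ ≡.sym (Up≡Lo red-u) ⟩
    Up u  ≤⟨ ⊏⇒Up≤ u⊏v ⟩
    Up v  ≡⟨ Up≡Lo red-v ⟩
    Lo v  ∎)
    where open ℕ.≤-Reasoning

  adj-⊏-blue-blue : ∀ {u v} → ¬ Red u → ¬ Red v → u ⊏ v → adj G u v ≡ (Lo v <ᵇ Lo u)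
  adj-⊏-blue-blue {u} {v} blue-u blue-v u⊏v = nonadjacent-Lo≤⇒adj≡ ¬uv Lo≤
    where
    ¬uv : adj G u v ≡ false
    ¬uv = blue-independent blue-u blue-v

    Lo≤ : Lo u ≤ Lo v
    Lo≤ with position u v
    ... | equal refl = ≤-refl
    ... | below u≺v  = Lo-mono (≺⇒≼ u≺v)
    ... | above v≺u  = blue⊏blue⇒Lo≤ blue-u blue-v (≤-antisym (⊏⇒Up≤ u⊏v) (Up-mono (≺⇒≼ v≺u))) u⊏v
    ... | crossing c = contradiction c (nonadjacent⇒¬crossing ¬uv)

  adj-⊏-red-blue : ∀ {u v} → Red u → ¬ Red v → u ⊏ v → adj G u v ≡ (Lo v <ᵇ Lo u)
  adj-⊏-red-blue {u} {v} red-u blue-v u⊏v with position u v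
  ... | equal refl = contradiction red-u blue-v
  ... | below u≺v  = nonadjacent-Lo≤⇒adj≡ (adj-≺ u≺v) (Lo-mono (≺⇒≼ u≺v))
  ... | above v≺u  = contradiction (⊏⇒Up≤ u⊏v) (<⇒≱ (Up-<-≺ red-u v≺u))
  ... | crossing c = trans (adj-crossing c) (≡.sym (<ᵇ-true (Lo-<-crossing red-u c)))

  adj-⊏-blue-red : ∀ {u v} → ¬ Red u → Red v → u ⊏ v → adj G u v ≡ (Lo v <ᵇ Lo u)
  adj-⊏-blue-red {u} {v} blue-u red-v u⊏v with position u v | blue⊏red⇒Up< blue-u red-v u⊏v
  ... | equal refl | _   = contradiction red-v blue-u
  ... | below u≺v  | _   = nonadjacent-Lo≤⇒adj≡ (adj-≺ u≺v) (Lo-mono (≺⇒≼ u≺v))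
  ... | above v≺u  | Up< = contradiction (Up-mono (≺⇒≼ v≺u)) (<⇒≱ Up<)
  ... | crossing c | Up< = contradiction (Up-≤-crossing red-v c) (<⇒≱ Up<)

  adj-⊏ : ∀ {u v} → u ⊏ v → adj G u v ≡ (Lo v <ᵇ Lo u)
  adj-⊏ {u} {v} u⊏v = byColour (Red? u) (Red? v)
    where
    byColour : Dec (Red u) → Dec (Red v) → adj G u v ≡ (Lo v <ᵇ Lo u)
    byColour (yes red-u)  (yes red-v)  = adj-⊏-red-red   red-u  red-v  u⊏v
    byColour (no  blue-u) (no  blue-v) = adj-⊏-blue-blue blue-u blue-v u⊏v
    byColour (yes red-u)  (no  blue-v) = adj-⊏-red-blue  red-u  blue-v u⊏v
    byColour (no  blue-u) (yes red-v)  = adj-⊏-blue-red  blue-u red-v  u⊏v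

  letter : Fin n → Fin (suc ∣ toSubset Red? ∣)
  letter v = fromℕ< (s≤s (∣toSubset∣-mono-≤ (redBelow? v) Red? proj₁))

  toℕ-letter : ∀ v → toℕ (letter v) ≡ Lo v
  toℕ-letter v = toℕ-fromℕ< _

  laterSmaller : Fin (suc ∣ toSubset Red? ∣) → Fin (suc ∣ toSubset Red? ∣) → Bool
  laterSmaller a b = toℕ b <ᵇ toℕ a

  open Ranking (<-isStrictTotalOrder ℕ.<-isStrictTotalOrder) key key-injective
    using (rank; rank-injective; rank-<⁻)

  isLetterGraph : IsLetterGraphOver (suc ∣ toSubset Red? ∣) G
  isLetterGraph = letterGraph-byOrder G rank rank-injective letter laterSmaller λ {u} {v} ru<rv →
    trans (adj-⊏ (rank-<⁻ ru<rv)) (≡.sym (cong₂ _<ᵇ_ (toℕ-letter v) (toℕ-letter u)))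

mainTheorem6 : (n : ℕ) (G : Graph n) → IsBipartite G → IsPermutationGraph G →
    LettericityAtMost (n / 2 + 1) G
mainTheorem6 n G (c , proper) (σ , τ , σ-injective , τ-injective , adj≡crossing) =
  suc ∣ colourClass c b ∣ , bound , isLetterGraph
  where
  b : Bool
  b = proj₁ (smallColourClass c)

  bound : suc ∣ colourClass c b ∣ ≤ n / 2 + 1
  bound = ≡.subst (_≤ n / 2 + 1) (ℕ.+-comm _ 1)
                  (ℕ.+-monoˡ-≤ 1 (m+m≤n⇒m≤n/2 (proj₂ (smallColourClass c))))

  sameColour⇒nonadjacent : ∀ {u v} → c u ≡ c v → adj G u v ≡ false
  sameColour⇒nonadjacent {u} {v} cu≡cv with adj G u v in uv
  ... | true  = contradiction cu≡cv (proper u v uv)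
  ... | false = refl

  open Lettering G σ τ σ-injective τ-injective adj≡crossing (λ v → c v Bool.≟ b)
    (λ cu≡b cv≡b → sameColour⇒nonadjacent (trans cu≡b (≡.sym cv≡b)))
    (λ cu≢b cv≢b → sameColour⇒nonadjacent (trans (¬-not cu≢b) (≡.sym (¬-not cv≢b))))
    using (isLetterGraph)
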